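{- Fix $k\ge3$. For $n\ge 1$, let $a_k^{(2n)}$ and $a_{k+1}^{(2n)}$ denote the coefficients of $x^k$ and $x^{k+1}$ in the independence polynomial $I(\bar A_{2n};x)$ of the antiregular $k$-hypergraph $\bar A_{2n}$. Then $$a_k^{(2n)}=\sum_{i=\lfloor\frac{k+1}{2}\rfloor}^{n}\binom{2i-1}{k-1},\qquad a_{k+1}^{(2n)}=\sum_{i=\lfloor\frac{k+1}{2}\rfloor}^{n-1}\binom{2i-1}{k-1}(n-i),$$ where empty sums are $0$.
   Context: All hypergraphs are $k$-uniform. For a binary string $b=b_1\cdots b_m$, $H(b)$ is the $k$-uniform hypergraph on $\{1,\dots,m\}$ in which a $k$-subset is a hyperedge iff its largest element $j$ satisfies $b_j=1$. For $m\le k-1$, $\bar A_m$ is the edgeless hypergraph on $m$ vertices; for $m\ge k$, $\bar A_m=H(b)$ with $b$ of length $m$, $b_1=\dots=b_{k-1}=0$, $b_k,\dots,b_m$ alternating, and $b_m=0$. A vertex set is independent if it contains no hyperedge, and $I(H;x)=\sum_{W\text{ independent}}x^{|W|}$. -}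

module Defs where

open import Data.Bool using (Bool; true; false; _∧_; _∨_; not; T)
open import Data.Nat using (ℕ; zero; suc; _+_; _∸_; _*_; _≤ᵇ_; _<ᵇ_; _≡ᵇ_; _/_; _%_)
open import Data.Nat.Combinatorics using (_C_)
open import Data.Fin using (Fin; toℕ)
open import Data.Fin.Subset using (Subset; ∣_∣; inside; outside)
open import Data.Fin.Subset.Properties using (_∈?_; _⊆?_)
open import Data.List using (List; []; _∷_; _++_; map; filterᵇ; length; upTo; allFin)
open import Data.Bool.ListAction using (any; all)
open import Data.Nat.ListAction using (sum)
open import Data.Vec using ([]; _∷_)
open import Relation.Nullary.Decidable using (⌊_⌋)

-- Conventions: vertex (i : Fin m) stands for the paper's vertex (toℕ i + 1) ∈ {1,…,m}.
-- A binary string b₁⋯bₘ is a function b : Fin m → Bool with b i = b_{toℕ i + 1}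
-- (true = 1, false = 0).

allSubsets : (m : ℕ) → List (Subset m)
allSubsets zero    = [] ∷ []
allSubsets (suc m) = map (outside ∷_) (allSubsets m) ++ map (inside ∷_) (allSubsets m)

largestHasOne : ∀ {m} → (Fin m → Bool) → Subset m → Bool
largestHasOne {m} b e =
  any (λ j → ⌊ j ∈? e ⌋ ∧ b j ∧ all (λ i → not ⌊ i ∈? e ⌋ ∨ (toℕ i ≤ᵇ toℕ j)) (allFin m)) (allFin m)

isHyperedge : (k : ℕ) → ∀ {m} → (Fin m → Bool) → Subset m → Bool
isHyperedge k b e = (∣ e ∣ ≡ᵇ k) ∧ largestHasOne b e

isIndependent : (k : ℕ) → ∀ {m} → (Fin m → Bool) → Subset m → Bool
isIndependent k {m} b W =
  not (any (λ e → ⌊ e ⊆? W ⌋ ∧ isHyperedge k b e) (allSubsets m))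

indepCoeff : (k : ℕ) → ∀ {m} → (Fin m → Bool) → ℕ → ℕ
indepCoeff k {m} b j =
  length (filterᵇ (λ W → (∣ W ∣ ≡ᵇ j) ∧ isIndependent k b W) (allSubsets m))

-- The string defining the antiregular k-hypergraph Ā_m.
-- m ≤ k-1 : all zeros (H(0⋯0) is the edgeless hypergraph on m vertices).
-- m ≥ k   : b_1 = … = b_{k-1} = 0, b_k, …, b_m alternating with b_m = 0,
--           i.e. for k ≤ j ≤ m, b_j = 1 iff m - j is odd.
antiregString : (k m : ℕ) → Fin m → Bool
antiregString k m i with m <ᵇ k
... | true  = false
... | false = (k ≤ᵇ j) ∧ ((m ∸ j) % 2 ≡ᵇ 1)
  where j = suc (toℕ i)

antiregCoeff : (k m j : ℕ) → ℕ
antiregCoeff k m j = indepCoeff k (antiregString k m) j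

sumFromTo : ℕ → ℕ → (ℕ → ℕ) → ℕ
sumFromTo lo hi f = sum (map (λ t → f (lo + t)) (upTo (suc hi ∸ lo)))

-- A hyperedge of H(b) is determined by its largest vertex. Adding a new largest vertex v therefore
-- creates exactly the edges e ∪ {v} with |e| = k - 1 if b_v = 1, and none if b_v = 0. So for j ≥ k the
-- independent j-sets of the larger hypergraph are the old ones together with, when b_v = 0, the sets
-- I ∪ {v} for independent (j-1)-sets I; and every (k-1)-set is independent. In Ā_{2n} the odd vertices
-- carry bit 1 as soon as they can top an edge and the even vertices carry bit 0, whence
--   a_k^{(2i)} = a_k^{(2i-2)} + C(2i-1, k-1)   and   a_{k+1}^{(2i)} = a_{k+1}^{(2i-2)} + a_k^{(2i-2)},
-- and summing these recurrences gives both formulas.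

module Submission where

open import Defs
open import Algebra.Bundles using (CommutativeMonoid)
import Algebra.Properties.CommutativeSemigroup as CommutativeSemigroupProperties
open import Data.Bool using (Bool; true; false; _∧_; _∨_; not; T; if_then_else_)
open import Data.Bool.ListAction using (any; all; or; and)
open import Data.Bool.Properties
  using (∨-assoc; ∨-identityʳ; ∨-zeroʳ; ∧-identityʳ; ∧-zeroʳ; ∧-comm; ∧-distribˡ-∨; T-≡;
         ∨-commutativeMonoid; ∨-∧-booleanAlgebra)
open import Algebra.Lattice.Properties.BooleanAlgebra ∨-∧-booleanAlgebra using (deMorgan₂)
open import Data.Empty using (⊥-elim)
open import Data.Fin using (Fin; zero; suc; toℕ)
open import Data.Fin.Properties using (toℕ<n)
open import Data.Fin.Subset using (Subset; ∣_∣; inside; outside)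
open import Data.Fin.Subset.Properties using (_∈?_; _⊆?_; ∣p∣≤n)
open import Data.List using (List; []; _∷_; _++_; map; filterᵇ; length; upTo; applyUpTo; allFin)
open import Data.List.Properties using (filter-++; length-++; map-tabulate; map-∘; map-cong; map-upTo)
open import Data.Nat using (ℕ; zero; suc; pred; _+_; _∸_; _*_; _/_; _%_; _≤ᵇ_; _<ᵇ_; _≡ᵇ_; _≤_; _<_; z≤n; s≤s)
open import Data.Nat.Combinatorics using (_C_; nCk+nC[k+1]≡[n+1]C[k+1]; k>n⇒nCk≡0)
open import Data.Nat.DivMod using ([m+kn]%n≡m%n; m*n%n≡0; m/n*n≤m)
open import Data.Nat.ListAction using (sum)
open import Data.Nat.Properties
  using (+-assoc; +-comm; +-identityʳ; *-comm; *-suc; *-identityʳ; *-monoˡ-≤; ≤-refl; ≤-reflexive; ≤-trans;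
         ≤-<-trans; <-irrefl; <⇒≱; ≰⇒>; n≤1+n; m<n⇒m<1+n; ≤-pred; ≡ᵇ⇒≡; ≤ᵇ-reflects-≤; ≤⇒≤ᵇ; ≤ᵇ⇒≤;
         +-commutativeSemigroup; +-∸-assoc; <⇒≤; m+n∸n≡m; <ᵇ⇒<; pred[m∸n]≡m∸[1+n])
open import Data.Product using (_×_; _,_; proj₁; proj₂)
open import Data.Vec using ([]; _∷_; _∷ʳ_)
open import Function using (_∘_; id; Equivalence)
open import Relation.Binary.PropositionalEquality
open import Relation.Nullary.Decidable using (⌊_⌋; ⌊⌋-map′; T?)
open import Relation.Nullary.Reflects using (ofʸ; ofⁿ)

private
  variable
    X Y : Set
    m : ℕ

  module ∨-Semigroup =
    CommutativeSemigroupProperties (CommutativeMonoid.commutativeSemigroup ∨-commutativeMonoid)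
  module +-Semigroup = CommutativeSemigroupProperties +-commutativeSemigroup

count : (X → Bool) → List X → ℕ
count p xs = length (filterᵇ p xs)

count-++ : ∀ (p : X → Bool) xs ys → count p (xs ++ ys) ≡ count p xs + count p ys
count-++ p xs ys = trans (cong length (filter-++ (T? ∘ p) xs ys)) (length-++ (filterᵇ p xs))

count-map : ∀ (p : Y → Bool) (f : X → Y) xs → count p (map f xs) ≡ count (p ∘ f) xs
count-map p f []       = refl
count-map p f (x ∷ xs) with p (f x)
... | true  = cong suc (count-map p f xs)
... | false = count-map p f xs

count-cong : ∀ {p q : X → Bool} → p ≗ q → ∀ xs → count p xs ≡ count q xs
count-cong p≗q []                  = refl
count-cong {p = p} {q} p≗q (x ∷ xs) with p x | q x | p≗q x
... | true  | .true  | refl = cong suc (count-cong p≗q xs)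
... | false | .false | refl = count-cong p≗q xs

count-false : ∀ (xs : List X) → count (λ _ → false) xs ≡ 0
count-false []       = refl
count-false (x ∷ xs) = count-false xs

count-unless : ∀ c (p : X → Bool) xs → count (λ x → not c ∧ p x) xs ≡ (if c then 0 else count p xs)
count-unless true  p xs = count-false xs
count-unless false p xs = refl

any-++ : ∀ (p : X → Bool) xs ys → any p (xs ++ ys) ≡ any p xs ∨ any p ys
any-++ p []       ys = refl
any-++ p (x ∷ xs) ys = trans (cong (p x ∨_) (any-++ p xs ys)) (sym (∨-assoc (p x) _ _))

any-map : ∀ (p : Y → Bool) (f : X → Y) xs → any p (map f xs) ≡ any (p ∘ f) xs
any-map p f xs = cong or (sym (map-∘ xs))

any-cong : ∀ {p q : X → Bool} → p ≗ q → ∀ xs → any p xs ≡ any q xs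
any-cong p≗q xs = cong or (map-cong p≗q xs)

any-∨ : ∀ (p q : X → Bool) xs → any (λ x → p x ∨ q x) xs ≡ any p xs ∨ any q xs
any-∨ p q []       = refl
any-∨ p q (x ∷ xs) = trans (cong ((p x ∨ q x) ∨_) (any-∨ p q xs)) (∨-Semigroup.interchange (p x) (q x) _ _)

any-false : ∀ (xs : List X) → any (λ _ → false) xs ≡ false
any-false []       = refl
any-false (x ∷ xs) = any-false xs

all-map : ∀ (p : Y → Bool) (f : X → Y) xs → all p (map f xs) ≡ all (p ∘ f) xs
all-map p f xs = cong and (sym (map-∘ xs))

all-cong : ∀ {p q : X → Bool} → p ≗ q → ∀ xs → all p xs ≡ all q xs
all-cong p≗q xs = cong and (map-cong p≗q xs)

any-allFin-suc : ∀ (p : Fin (suc m) → Bool) → any p (allFin (suc m)) ≡ p zero ∨ any (p ∘ suc) (allFin m)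
any-allFin-suc {m} p =
  cong (p zero ∨_) (trans (cong (any p) (sym (map-tabulate id suc))) (any-map p suc (allFin m)))

all-allFin-suc : ∀ (p : Fin (suc m) → Bool) → all p (allFin (suc m)) ≡ p zero ∧ all (p ∘ suc) (allFin m)
all-allFin-suc {m} p =
  cong (p zero ∧_) (trans (cong (all p) (sym (map-tabulate id suc))) (all-map p suc (allFin m)))

suc≤ᵇsuc : ∀ a c → (suc a ≤ᵇ suc c) ≡ (a ≤ᵇ c)
suc≤ᵇsuc zero    c = refl
suc≤ᵇsuc (suc a) c = refl

>⇒≤ᵇ≡false : ∀ {a c} → c < a → (a ≤ᵇ c) ≡ false
>⇒≤ᵇ≡false {a} {c} c<a with a ≤ᵇ c | ≤ᵇ-reflects-≤ a c
... | true  | ofʸ a≤c = ⊥-elim (<⇒≱ c<a a≤c)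
... | false | _       = refl

∨-absorbs-implied : ∀ a c {p q} → (T p → T q) → (a ∨ p) ∨ (c ∨ q) ≡ (a ∨ c) ∨ q
∨-absorbs-implied a c {p} {q} p⇒q = trans (∨-Semigroup.interchange a p c q) (cong ((a ∨ c) ∨_) (p∨q≡q p q p⇒q))
  where
  p∨q≡q : ∀ p q → (T p → T q) → p ∨ q ≡ q
  p∨q≡q false q     _   = refl
  p∨q≡q true  true  _   = refl
  p∨q≡q true  false p⇒q = ⊥-elim (p⇒q _)

∧-monoʳ-T : ∀ x {y z} → (T y → T z) → T (x ∧ y) → T (x ∧ z)
∧-monoʳ-T true  y⇒z = y⇒z
∧-monoʳ-T false _   ()

allSubsets-any-suc : ∀ (p : Subset (suc m) → Bool) →
  any p (allSubsets (suc m)) ≡ any (p ∘ (outside ∷_)) (allSubsets m) ∨ any (p ∘ (inside ∷_)) (allSubsets m)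
allSubsets-any-suc {m} p =
  trans (any-++ p (map (outside ∷_) (allSubsets m)) (map (inside ∷_) (allSubsets m)))
        (cong₂ _∨_ (any-map p (outside ∷_) (allSubsets m)) (any-map p (inside ∷_) (allSubsets m)))

allSubsets-count-suc : ∀ m (p : Subset (suc m) → Bool) →
  count p (allSubsets (suc m)) ≡ count (p ∘ (outside ∷_)) (allSubsets m) + count (p ∘ (inside ∷_)) (allSubsets m)
allSubsets-count-suc m p =
  trans (count-++ p (map (outside ∷_) (allSubsets m)) (map (inside ∷_) (allSubsets m)))
        (cong₂ _+_ (count-map p (outside ∷_) (allSubsets m)) (count-map p (inside ∷_) (allSubsets m)))

allSubsets-count-∷ʳ : ∀ m (p : Subset (suc m) → Bool) →
  count p (allSubsets (suc m))
    ≡ count (λ W → p (W ∷ʳ outside)) (allSubsets m) + count (λ W → p (W ∷ʳ inside)) (allSubsets m)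
allSubsets-count-∷ʳ zero    p =
  trans (allSubsets-count-suc zero p)
        (cong₂ _+_ (count-cong {p = p ∘ (outside ∷_)} {q = λ W → p (W ∷ʳ outside)} (λ { [] → refl }) (allSubsets 0))
                   (count-cong {p = p ∘ (inside ∷_)} {q = λ W → p (W ∷ʳ inside)} (λ { [] → refl }) (allSubsets 0)))
allSubsets-count-∷ʳ (suc m) p = begin
  count p (allSubsets (suc (suc m)))
    ≡⟨ allSubsets-count-suc (suc m) p ⟩
  count (p ∘ (outside ∷_)) (allSubsets (suc m)) + count (p ∘ (inside ∷_)) (allSubsets (suc m))
    ≡⟨ cong₂ _+_ (allSubsets-count-∷ʳ m (p ∘ (outside ∷_))) (allSubsets-count-∷ʳ m (p ∘ (inside ∷_))) ⟩
  (oo + oi) + (io + ii)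
    ≡⟨ +-Semigroup.interchange oo oi io ii ⟩
  (oo + io) + (oi + ii)
    ≡⟨ sym (cong₂ _+_ (allSubsets-count-suc m (λ W → p (W ∷ʳ outside)))
                      (allSubsets-count-suc m (λ W → p (W ∷ʳ inside)))) ⟩
  count (λ W → p (W ∷ʳ outside)) (allSubsets (suc m)) + count (λ W → p (W ∷ʳ inside)) (allSubsets (suc m)) ∎
  where
  open ≡-Reasoning
  oo oi io ii : ℕ
  oo = count (λ W → p (outside ∷ (W ∷ʳ outside))) (allSubsets m)
  oi = count (λ W → p (outside ∷ (W ∷ʳ inside))) (allSubsets m)
  io = count (λ W → p (inside ∷ (W ∷ʳ outside))) (allSubsets m)
  ii = count (λ W → p (inside ∷ (W ∷ʳ inside))) (allSubsets m)

allSubsets-count-size : ∀ m j → count (λ W → ∣ W ∣ ≡ᵇ j) (allSubsets m) ≡ m C j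
allSubsets-count-size zero    zero    = refl
allSubsets-count-size zero    (suc j) = refl
allSubsets-count-size (suc m) zero    =
  trans (allSubsets-count-suc m _) (cong₂ _+_ (allSubsets-count-size m zero) (count-false (allSubsets m)))
allSubsets-count-size (suc m) (suc j) = begin
  count (λ W → ∣ W ∣ ≡ᵇ suc j) (allSubsets (suc m))  ≡⟨ allSubsets-count-suc m _ ⟩
  count (λ W → ∣ W ∣ ≡ᵇ suc j) (allSubsets m) + count (λ W → ∣ W ∣ ≡ᵇ j) (allSubsets m)
    ≡⟨ cong₂ _+_ (allSubsets-count-size m (suc j)) (allSubsets-count-size m j) ⟩
  m C suc j + m C j                                  ≡⟨ +-comm (m C suc j) (m C j) ⟩
  m C j + m C suc j                                  ≡⟨ nCk+nC[k+1]≡[n+1]C[k+1] m j ⟩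
  suc m C suc j                                      ∎
  where open ≡-Reasoning

∣p∷ʳoutside∣≡∣p∣ : ∀ (W : Subset m) → ∣ W ∷ʳ outside ∣ ≡ ∣ W ∣
∣p∷ʳoutside∣≡∣p∣ []            = refl
∣p∷ʳoutside∣≡∣p∣ (inside ∷ W)  = cong suc (∣p∷ʳoutside∣≡∣p∣ W)
∣p∷ʳoutside∣≡∣p∣ (outside ∷ W) = ∣p∷ʳoutside∣≡∣p∣ W

∣p∷ʳinside∣≡1+∣p∣ : ∀ (W : Subset m) → ∣ W ∷ʳ inside ∣ ≡ suc ∣ W ∣
∣p∷ʳinside∣≡1+∣p∣ []            = refl
∣p∷ʳinside∣≡1+∣p∣ (inside ∷ W)  = cong suc (∣p∷ʳinside∣≡1+∣p∣ W)
∣p∷ʳinside∣≡1+∣p∣ (outside ∷ W) = ∣p∷ʳinside∣≡1+∣p∣ W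

-- largestHasOne b e unfolds to anyMember e (λ j → b j ∧ allMembers e (λ i → toℕ i ≤ᵇ toℕ j)).
anyMember : Subset m → (Fin m → Bool) → Bool
anyMember {m} e f = any (λ j → ⌊ j ∈? e ⌋ ∧ f j) (allFin m)

allMembers : Subset m → (Fin m → Bool) → Bool
allMembers {m} e f = all (λ i → not ⌊ i ∈? e ⌋ ∨ f i) (allFin m)

⌊zero∈?∷⌋ : ∀ x (e : Subset m) → ⌊ zero ∈? (x ∷ e) ⌋ ≡ x
⌊zero∈?∷⌋ inside  e = refl
⌊zero∈?∷⌋ outside e = refl

⌊suc∈?∷⌋ : ∀ (i : Fin m) x e → ⌊ suc i ∈? (x ∷ e) ⌋ ≡ ⌊ i ∈? e ⌋
⌊suc∈?∷⌋ i x e = ⌊⌋-map′ _ _ (i ∈? e)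

anyMember-cong : ∀ (e : Subset m) {f g} → f ≗ g → anyMember e f ≡ anyMember e g
anyMember-cong {m} e f≗g = any-cong (λ j → cong (⌊ j ∈? e ⌋ ∧_) (f≗g j)) (allFin m)

allMembers-cong : ∀ (e : Subset m) {f g} → f ≗ g → allMembers e f ≡ allMembers e g
allMembers-cong {m} e f≗g = all-cong (λ i → cong (not ⌊ i ∈? e ⌋ ∨_) (f≗g i)) (allFin m)

anyMember-∷ : ∀ x (e : Subset m) f → anyMember (x ∷ e) f ≡ (x ∧ f zero) ∨ anyMember e (f ∘ suc)
anyMember-∷ {m} x e f = trans (any-allFin-suc (λ j → ⌊ j ∈? (x ∷ e) ⌋ ∧ f j))
  (cong₂ _∨_ (cong (_∧ f zero) (⌊zero∈?∷⌋ x e))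
             (any-cong (λ j → cong (_∧ f (suc j)) (⌊suc∈?∷⌋ j x e)) (allFin m)))

allMembers-∷ : ∀ x (e : Subset m) f → allMembers (x ∷ e) f ≡ (not x ∨ f zero) ∧ allMembers e (f ∘ suc)
allMembers-∷ {m} x e f = trans (all-allFin-suc (λ i → not ⌊ i ∈? (x ∷ e) ⌋ ∨ f i))
  (cong₂ _∧_ (cong (λ t → not t ∨ f zero) (⌊zero∈?∷⌋ x e))
             (all-cong (λ i → cong (λ t → not t ∨ f (suc i)) (⌊suc∈?∷⌋ i x e)) (allFin m)))

allMembers-false : ∀ (e : Subset m) → allMembers e (λ _ → false) ≡ (∣ e ∣ ≡ᵇ 0)
allMembers-false []            = refl
allMembers-false (inside ∷ e)  = refl
allMembers-false (outside ∷ e) = trans (allMembers-∷ outside e _) (allMembers-false e)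

largestHasOne-cong : ∀ {b c : Fin m → Bool} → b ≗ c → ∀ e → largestHasOne b e ≡ largestHasOne c e
largestHasOne-cong b≗c e = anyMember-cong e (λ j → cong (_∧ _) (b≗c j))

largestHasOne-∷ : ∀ (b : Fin (suc m) → Bool) x (e : Subset m) →
  largestHasOne b (x ∷ e) ≡ (x ∧ b zero ∧ (∣ e ∣ ≡ᵇ 0)) ∨ largestHasOne (b ∘ suc) e
largestHasOne-∷ b x e = trans (anyMember-∷ x e _)
  (cong₂ (λ u v → (x ∧ b zero ∧ u) ∨ v) allBelowZero
         (anyMember-cong e (λ j → cong (b (suc j) ∧_) (allBelowSuc j))))
  where
  allBelowZero : allMembers (x ∷ e) (λ i → toℕ i ≤ᵇ 0) ≡ (∣ e ∣ ≡ᵇ 0)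
  allBelowZero = trans (allMembers-∷ x e _) (cong₂ _∧_ (∨-zeroʳ (not x)) (allMembers-false e))
  allBelowSuc : ∀ j → allMembers (x ∷ e) (λ i → toℕ i ≤ᵇ suc (toℕ j)) ≡ allMembers e (λ i → toℕ i ≤ᵇ toℕ j)
  allBelowSuc j = trans (allMembers-∷ x e _)
    (cong₂ _∧_ (∨-zeroʳ (not x)) (allMembers-cong e (λ i → suc≤ᵇsuc (toℕ i) (toℕ j))))

isHyperedge-outside : ∀ K (b : Fin (suc m) → Bool) e → isHyperedge K b (outside ∷ e) ≡ isHyperedge K (b ∘ suc) e
isHyperedge-outside K b e = cong ((∣ e ∣ ≡ᵇ K) ∧_) (largestHasOne-∷ b outside e)

isHyperedge-inside : ∀ k (b : Fin (suc m) → Bool) e →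
  isHyperedge (suc k) b (inside ∷ e) ≡ (∣ e ∣ ≡ᵇ k) ∧ ((b zero ∧ (∣ e ∣ ≡ᵇ 0)) ∨ largestHasOne (b ∘ suc) e)
isHyperedge-inside k b e = cong ((∣ e ∣ ≡ᵇ k) ∧_) (largestHasOne-∷ b inside e)

-- A K-edge of w ∷ W avoids vertex 0, or it is {0} ∪ e with e = ∅ (when K = 1) or e a (K-1)-edge
-- of W; in the latter case the largest vertex of the edge is that of e.
mutual
  hasEdge : ℕ → (Fin m → Bool) → Subset m → Bool
  hasEdge K b []      = false
  hasEdge K b (w ∷ W) = hasEdge K (b ∘ suc) W ∨ (w ∧ hasEdgeThrough₀ K b W)

  hasEdgeThrough₀ : ℕ → (Fin (suc m) → Bool) → Subset m → Bool
  hasEdgeThrough₀ zero    b W = false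
  hasEdgeThrough₀ (suc k) b W = (b zero ∧ (k ≡ᵇ 0)) ∨ hasEdge k (b ∘ suc) W

any-emptySubset : ∀ c k (W : Subset m) →
  any (λ e → ⌊ e ⊆? W ⌋ ∧ (∣ e ∣ ≡ᵇ k) ∧ c ∧ (∣ e ∣ ≡ᵇ 0)) (allSubsets m) ≡ c ∧ (k ≡ᵇ 0)
any-emptySubset c zero    [] = ∨-identityʳ _
any-emptySubset c (suc k) [] = sym (∧-zeroʳ c)
any-emptySubset {suc m} c k (w ∷ W) = begin
  any P (allSubsets (suc m))
    ≡⟨ allSubsets-any-suc P ⟩
  any (P ∘ (outside ∷_)) (allSubsets m) ∨ any (P ∘ (inside ∷_)) (allSubsets m)
    ≡⟨ cong₂ _∨_ (trans (any-cong (λ e → cong (_∧ _) (⌊⌋-map′ _ _ (e ⊆? W))) (allSubsets m)) (any-emptySubset c k W))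
                 (trans (any-cong nonempty (allSubsets m)) (any-false (allSubsets m))) ⟩
  (c ∧ (k ≡ᵇ 0)) ∨ false
    ≡⟨ ∨-identityʳ _ ⟩
  c ∧ (k ≡ᵇ 0) ∎
  where
  open ≡-Reasoning
  P : Subset (suc m) → Bool
  P e = ⌊ e ⊆? (w ∷ W) ⌋ ∧ (∣ e ∣ ≡ᵇ k) ∧ c ∧ (∣ e ∣ ≡ᵇ 0)
  nonempty : ∀ e → P (inside ∷ e) ≡ false
  nonempty e = trans (cong (λ t → ⌊ inside ∷ e ⊆? w ∷ W ⌋ ∧ (suc ∣ e ∣ ≡ᵇ k) ∧ t) (∧-zeroʳ c))
                     (trans (cong (⌊ inside ∷ e ⊆? w ∷ W ⌋ ∧_) (∧-zeroʳ _)) (∧-zeroʳ _))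

any-hyperedge≡hasEdge : ∀ K (b : Fin m → Bool) W →
  any (λ e → ⌊ e ⊆? W ⌋ ∧ isHyperedge K b e) (allSubsets m) ≡ hasEdge K b W
any-hyperedge≡hasEdge K b []      = trans (∨-identityʳ _) (∧-zeroʳ _)
any-hyperedge≡hasEdge {suc m} K b (w ∷ W) = begin
  any P (allSubsets (suc m))
    ≡⟨ allSubsets-any-suc P ⟩
  any (P ∘ (outside ∷_)) S ∨ any (P ∘ (inside ∷_)) S
    ≡⟨ cong₂ _∨_ avoiding (through w K) ⟩
  hasEdge K (b ∘ suc) W ∨ (w ∧ hasEdgeThrough₀ K b W) ∎
  where
  open ≡-Reasoning
  S = allSubsets m
  P : Subset (suc m) → Bool
  P e = ⌊ e ⊆? (w ∷ W) ⌋ ∧ isHyperedge K b e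
  avoiding : any (P ∘ (outside ∷_)) S ≡ hasEdge K (b ∘ suc) W
  avoiding = trans (any-cong (λ e → cong₂ _∧_ (⌊⌋-map′ _ _ (e ⊆? W)) (isHyperedge-outside K b e)) S)
                   (any-hyperedge≡hasEdge K (b ∘ suc) W)
  through : ∀ w K →
    any (λ e → ⌊ inside ∷ e ⊆? w ∷ W ⌋ ∧ isHyperedge K b (inside ∷ e)) S ≡ w ∧ hasEdgeThrough₀ K b W
  through outside K       = any-false S
  through inside  zero    = trans (any-cong (λ e → ∧-zeroʳ _) S) (any-false S)
  through inside  (suc k) = begin
    any (λ e → ⌊ inside ∷ e ⊆? inside ∷ W ⌋ ∧ isHyperedge (suc k) b (inside ∷ e)) S
      ≡⟨ any-cong split S ⟩
    any (λ e → singleton e ∨ edge e) S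
      ≡⟨ any-∨ singleton edge S ⟩
    any singleton S ∨ any edge S
      ≡⟨ cong₂ _∨_ (any-emptySubset (b zero) k W) (any-hyperedge≡hasEdge k (b ∘ suc) W) ⟩
    (b zero ∧ (k ≡ᵇ 0)) ∨ hasEdge k (b ∘ suc) W ∎
    where
    singleton edge : Subset m → Bool
    singleton e = ⌊ e ⊆? W ⌋ ∧ (∣ e ∣ ≡ᵇ k) ∧ b zero ∧ (∣ e ∣ ≡ᵇ 0)
    edge      e = ⌊ e ⊆? W ⌋ ∧ isHyperedge k (b ∘ suc) e
    split : ∀ e → ⌊ inside ∷ e ⊆? inside ∷ W ⌋ ∧ isHyperedge (suc k) b (inside ∷ e) ≡ singleton e ∨ edge e
    split e = begin
      ⌊ inside ∷ e ⊆? inside ∷ W ⌋ ∧ isHyperedge (suc k) b (inside ∷ e)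
        ≡⟨ cong₂ _∧_ (⌊⌋-map′ _ _ (e ⊆? W)) (isHyperedge-inside k b e) ⟩
      ⌊ e ⊆? W ⌋ ∧ (∣ e ∣ ≡ᵇ k) ∧ ((b zero ∧ (∣ e ∣ ≡ᵇ 0)) ∨ largestHasOne (b ∘ suc) e)
        ≡⟨ cong (⌊ e ⊆? W ⌋ ∧_) (∧-distribˡ-∨ (∣ e ∣ ≡ᵇ k) _ _) ⟩
      ⌊ e ⊆? W ⌋ ∧ (((∣ e ∣ ≡ᵇ k) ∧ b zero ∧ (∣ e ∣ ≡ᵇ 0)) ∨ isHyperedge k (b ∘ suc) e)
        ≡⟨ ∧-distribˡ-∨ ⌊ e ⊆? W ⌋ _ _ ⟩
      singleton e ∨ edge e ∎

isIndependent≡not-hasEdge : ∀ K (b : Fin m → Bool) W → isIndependent K b W ≡ not (hasEdge K b W)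
isIndependent≡not-hasEdge K b W = cong not (any-hyperedge≡hasEdge K b W)

hasEdge-zero : ∀ (b : Fin m → Bool) W → hasEdge 0 b W ≡ false
hasEdge-zero b []      = refl
hasEdge-zero b (w ∷ W) = trans (cong (_∨ (w ∧ false)) (hasEdge-zero (b ∘ suc) W)) (∧-zeroʳ w)

hasEdge-small : ∀ K (b : Fin m → Bool) W → ∣ W ∣ < K → hasEdge K b W ≡ false
hasEdge-small K             b []            _ = refl
hasEdge-small K             b (outside ∷ W) ∣W∣<K =
  trans (∨-identityʳ _) (hasEdge-small K (b ∘ suc) W ∣W∣<K)
hasEdge-small (suc zero)    b (inside ∷ W)  (s≤s ())
hasEdge-small (suc (suc k)) b (inside ∷ W)  (s≤s ∣W∣<1+k) =
  trans (cong₂ (λ u v → u ∨ (b zero ∧ false) ∨ v)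
               (hasEdge-small (suc (suc k)) (b ∘ suc) W (m<n⇒m<1+n ∣W∣<1+k))
               (hasEdge-small (suc k) (b ∘ suc) W ∣W∣<1+k))
        (trans (∨-identityʳ _) (∧-zeroʳ (b zero)))

hasEdge-∷ʳ : ∀ k (B : ℕ → Bool) (W : Subset m) w →
  hasEdge (suc k) (B ∘ toℕ) (W ∷ʳ w) ≡ hasEdge (suc k) (B ∘ toℕ) W ∨ (w ∧ B m ∧ (k ≤ᵇ ∣ W ∣))
hasEdge-∷ʳ zero    B []            w = cong (w ∧_) (∨-identityʳ _)
hasEdge-∷ʳ (suc k) B []            w = cong (w ∧_) (∨-identityʳ _)
hasEdge-∷ʳ {suc m} k B (outside ∷ W) w =
  trans (cong (_∨ false) (hasEdge-∷ʳ k (B ∘ suc) W w))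
        (∨-Semigroup.xy∙z≈xz∙y (hasEdge (suc k) (B ∘ suc ∘ toℕ) W) (w ∧ B (suc m) ∧ (k ≤ᵇ ∣ W ∣)) false)
hasEdge-∷ʳ {suc m} zero B (inside ∷ W) w =
  trans (cong₂ (λ u v → u ∨ (B 0 ∧ true) ∨ v)
               (hasEdge-∷ʳ zero (B ∘ suc) W w)
               (trans (hasEdge-zero (B ∘ suc ∘ toℕ) (W ∷ʳ w)) (sym (hasEdge-zero (B ∘ suc ∘ toℕ) W))))
        (∨-Semigroup.xy∙z≈xz∙y (hasEdge 1 (B ∘ suc ∘ toℕ) W) (w ∧ B (suc m) ∧ true)
                               ((B 0 ∧ true) ∨ hasEdge 0 (B ∘ suc ∘ toℕ) W))
hasEdge-∷ʳ {suc m} (suc k) B (inside ∷ W) w = begin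
  hasEdge (2 + k) b W′ ∨ (B 0 ∧ false) ∨ hasEdge (suc k) b W′
    ≡⟨ cong₂ (λ u v → u ∨ (B 0 ∧ false) ∨ v) (hasEdge-∷ʳ (suc k) (B ∘ suc) W w) (hasEdge-∷ʳ k (B ∘ suc) W w) ⟩
  (hasEdge (2 + k) b W ∨ p) ∨ (B 0 ∧ false) ∨ (hasEdge (suc k) b W ∨ q)
    ≡⟨ cong ((hasEdge (2 + k) b W ∨ p) ∨_) (sym (∨-assoc (B 0 ∧ false) _ q)) ⟩
  (hasEdge (2 + k) b W ∨ p) ∨ ((B 0 ∧ false) ∨ hasEdge (suc k) b W) ∨ q
    ≡⟨ ∨-absorbs-implied (hasEdge (2 + k) b W) _ (∧-monoʳ-T w (∧-monoʳ-T (B (suc m)) (≤ᵇ-pred k ∣ W ∣))) ⟩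
  (hasEdge (2 + k) b W ∨ (B 0 ∧ false) ∨ hasEdge (suc k) b W) ∨ q
    ≡⟨ cong (λ t → (hasEdge (2 + k) b W ∨ (B 0 ∧ false) ∨ hasEdge (suc k) b W) ∨ (w ∧ B (suc m) ∧ t))
            (sym (suc≤ᵇsuc k ∣ W ∣)) ⟩
  (hasEdge (2 + k) b W ∨ (B 0 ∧ false) ∨ hasEdge (suc k) b W) ∨ (w ∧ B (suc m) ∧ (suc k ≤ᵇ suc ∣ W ∣)) ∎
  where
  open ≡-Reasoning
  b : ∀ {n} → Fin n → Bool
  b = B ∘ suc ∘ toℕ
  W′ = W ∷ʳ w
  p q : Bool
  p = w ∧ B (suc m) ∧ (suc k ≤ᵇ ∣ W ∣)
  q = w ∧ B (suc m) ∧ (k ≤ᵇ ∣ W ∣)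
  ≤ᵇ-pred : ∀ k n → T (suc k ≤ᵇ n) → T (k ≤ᵇ n)
  ≤ᵇ-pred k n = ≤⇒≤ᵇ ∘ ≤-trans (n≤1+n k) ∘ ≤ᵇ⇒≤ (suc k) n

isIndependent-∷ʳ : ∀ k (B : ℕ → Bool) (W : Subset m) w →
  isIndependent (suc k) (B ∘ toℕ) (W ∷ʳ w) ≡ isIndependent (suc k) (B ∘ toℕ) W ∧ not (w ∧ B m ∧ (k ≤ᵇ ∣ W ∣))
isIndependent-∷ʳ {m} k B W w = begin
  isIndependent (suc k) (B ∘ toℕ) (W ∷ʳ w)
    ≡⟨ isIndependent≡not-hasEdge (suc k) (B ∘ toℕ) (W ∷ʳ w) ⟩
  not (hasEdge (suc k) (B ∘ toℕ) (W ∷ʳ w))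
    ≡⟨ cong not (hasEdge-∷ʳ k B W w) ⟩
  not (hasEdge (suc k) (B ∘ toℕ) W ∨ top)
    ≡⟨ deMorgan₂ (hasEdge (suc k) (B ∘ toℕ) W) top ⟩
  not (hasEdge (suc k) (B ∘ toℕ) W) ∧ not top
    ≡⟨ cong (_∧ not top) (sym (isIndependent≡not-hasEdge (suc k) (B ∘ toℕ) W)) ⟩
  isIndependent (suc k) (B ∘ toℕ) W ∧ not top ∎
  where
  open ≡-Reasoning
  top = w ∧ B m ∧ (k ≤ᵇ ∣ W ∣)

indepCoeff-cong : ∀ K {b c : Fin m → Bool} → b ≗ c → ∀ j → indepCoeff K b j ≡ indepCoeff K c j
indepCoeff-cong {m} K b≗c j = count-cong
  (λ W → cong (λ t → (∣ W ∣ ≡ᵇ j) ∧ not t)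
    (any-cong (λ e → cong (λ t → ⌊ e ⊆? W ⌋ ∧ (∣ e ∣ ≡ᵇ K) ∧ t) (largestHasOne-cong b≗c e)) (allSubsets m)))
  (allSubsets m)

indepCoeff-vanishes : ∀ K (b : Fin m → Bool) {j} → m < j → indepCoeff K b j ≡ 0
indepCoeff-vanishes {m} K b {j} m<j = trans (count-cong tooLarge (allSubsets m)) (count-false (allSubsets m))
  where
  tooLarge : ∀ W → (∣ W ∣ ≡ᵇ j) ∧ isIndependent K b W ≡ false
  tooLarge W with ∣ W ∣ ≡ᵇ j in ∣W∣≡j
  ... | false = refl
  ... | true  = ⊥-elim (<-irrefl (≡ᵇ⇒≡ _ _ (Equivalence.from T-≡ ∣W∣≡j)) (≤-<-trans (∣p∣≤n W) m<j))

indepCoeff-belowEdgeSize : ∀ k (b : Fin m → Bool) → indepCoeff (suc k) b k ≡ m C k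
indepCoeff-belowEdgeSize {m} k b = trans (count-cong allIndependent (allSubsets m)) (allSubsets-count-size m k)
  where
  allIndependent : ∀ W → (∣ W ∣ ≡ᵇ k) ∧ isIndependent (suc k) b W ≡ (∣ W ∣ ≡ᵇ k)
  allIndependent W with ∣ W ∣ ≡ᵇ k in ∣W∣≡k
  ... | false = refl
  ... | true  = trans (isIndependent≡not-hasEdge (suc k) b W)
                      (cong not (hasEdge-small (suc k) b W (s≤s (≤-reflexive (≡ᵇ⇒≡ _ _ (Equivalence.from T-≡ ∣W∣≡k))))))

indepCoeff-∷ʳ : ∀ k (B : ℕ → Bool) m j → k ≤ j →
  indepCoeff (suc k) {suc m} (B ∘ toℕ) (suc j)
    ≡ indepCoeff (suc k) {m} (B ∘ toℕ) (suc j) + (if B m then 0 else indepCoeff (suc k) {m} (B ∘ toℕ) j)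
indepCoeff-∷ʳ k B m j k≤j =
  trans (allSubsets-count-∷ʳ m _)
        (cong₂ _+_ (count-cong withoutTop (allSubsets m))
                   (trans (count-cong withTop (allSubsets m)) (count-unless (B m) _ (allSubsets m))))
  where
  I : ∀ {n} → Subset n → Bool
  I = isIndependent (suc k) (B ∘ toℕ)
  withoutTop : ∀ W → (∣ W ∷ʳ outside ∣ ≡ᵇ suc j) ∧ I (W ∷ʳ outside) ≡ (∣ W ∣ ≡ᵇ suc j) ∧ I W
  withoutTop W = cong₂ (λ s i → (s ≡ᵇ suc j) ∧ i) (∣p∷ʳoutside∣≡∣p∣ W)
                       (trans (isIndependent-∷ʳ k B W outside) (∧-identityʳ (I W)))
  topVertex : ∀ s i → (s ≡ᵇ j) ∧ (i ∧ not (B m ∧ (k ≤ᵇ s))) ≡ not (B m) ∧ (s ≡ᵇ j) ∧ i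
  topVertex s i with s ≡ᵇ j in s≡j
  ... | false = sym (∧-zeroʳ (not (B m)))
  ... | true  = begin
    i ∧ not (B m ∧ (k ≤ᵇ s)) ≡⟨ cong (λ t → i ∧ not (B m ∧ t)) k≤s ⟩
    i ∧ not (B m ∧ true)     ≡⟨ cong (λ t → i ∧ not t) (∧-identityʳ (B m)) ⟩
    i ∧ not (B m)            ≡⟨ ∧-comm i _ ⟩
    not (B m) ∧ i            ∎
    where
    open ≡-Reasoning
    k≤s : (k ≤ᵇ s) ≡ true
    k≤s = Equivalence.to T-≡ (≤⇒≤ᵇ (subst (k ≤_) (sym (≡ᵇ⇒≡ s j (Equivalence.from T-≡ s≡j))) k≤j))
  withTop : ∀ W → (∣ W ∷ʳ inside ∣ ≡ᵇ suc j) ∧ I (W ∷ʳ inside) ≡ not (B m) ∧ (∣ W ∣ ≡ᵇ j) ∧ I W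
  withTop W = trans (cong₂ (λ s i → (s ≡ᵇ suc j) ∧ i) (∣p∷ʳinside∣≡1+∣p∣ W) (isIndependent-∷ʳ k B W inside))
                    (topVertex ∣ W ∣ (I W))

sumBelow : ℕ → (ℕ → ℕ) → ℕ
sumBelow zero    f = 0
sumBelow (suc n) f = f 0 + sumBelow n (f ∘ suc)

sumBelow-suc : ∀ n f → sumBelow (suc n) f ≡ sumBelow n f + f n
sumBelow-suc zero    f = +-comm (f 0) 0
sumBelow-suc (suc n) f = trans (cong (f 0 +_) (sumBelow-suc n (f ∘ suc))) (sym (+-assoc (f 0) _ _))

sumBelow-cong : ∀ n {f g} → (∀ l → l < n → f l ≡ g l) → sumBelow n f ≡ sumBelow n g
sumBelow-cong zero    f≡g = refl
sumBelow-cong (suc n) f≡g = cong₂ _+_ (f≡g 0 (s≤s z≤n)) (sumBelow-cong n (λ l l<n → f≡g (suc l) (s≤s l<n)))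

sumBelow-+ : ∀ n f g → sumBelow n (λ l → f l + g l) ≡ sumBelow n f + sumBelow n g
sumBelow-+ zero    f g = refl
sumBelow-+ (suc n) f g =
  trans (cong (f 0 + g 0 +_) (sumBelow-+ n (f ∘ suc) (g ∘ suc))) (+-Semigroup.interchange (f 0) (g 0) _ _)

sumBelow-weighted-suc : ∀ f i →
  sumBelow (suc i) (λ l → f l * (suc i ∸ l)) ≡ sumBelow i (λ l → f l * (i ∸ l)) + sumBelow (suc i) f
sumBelow-weighted-suc f i = begin
  sumBelow (suc i) (λ l → f l * (suc i ∸ l))
    ≡⟨ sumBelow-suc i _ ⟩
  sumBelow i (λ l → f l * (suc i ∸ l)) + f i * (suc i ∸ i)
    ≡⟨ cong₂ _+_ (sumBelow-cong i oneMore) (lastTerm i) ⟩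
  sumBelow i (λ l → f l * (i ∸ l) + f l) + f i
    ≡⟨ cong (_+ f i) (sumBelow-+ i _ f) ⟩
  (weighted + sumBelow i f) + f i
    ≡⟨ +-assoc weighted (sumBelow i f) (f i) ⟩
  weighted + (sumBelow i f + f i)
    ≡⟨ cong (weighted +_) (sym (sumBelow-suc i f)) ⟩
  weighted + sumBelow (suc i) f ∎
  where
  open ≡-Reasoning
  weighted = sumBelow i (λ l → f l * (i ∸ l))
  oneMore : ∀ l → l < i → f l * (suc i ∸ l) ≡ f l * (i ∸ l) + f l
  oneMore l l<i = trans (cong (f l *_) (+-∸-assoc 1 (<⇒≤ l<i))) (trans (*-suc (f l) (i ∸ l)) (+-comm (f l) _))
  lastTerm : ∀ i → f i * (suc i ∸ i) ≡ f i
  lastTerm i = trans (cong (f i *_) (m+n∸n≡m 1 i)) (*-identityʳ (f i))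

sum-applyUpTo : ∀ n f → sum (applyUpTo f n) ≡ sumBelow n f
sum-applyUpTo zero    f = refl
sum-applyUpTo (suc n) f = cong (f 0 +_) (sum-applyUpTo n (f ∘ suc))

sumBelow-shift : ∀ lo n f → (∀ l → l < lo → f l ≡ 0) → sumBelow (n ∸ lo) (λ t → f (lo + t)) ≡ sumBelow n f
sumBelow-shift zero     n       f _      = refl
sumBelow-shift (suc lo) zero    f _      = refl
sumBelow-shift (suc lo) (suc n) f vanish =
  trans (sumBelow-shift lo n (f ∘ suc) (λ l l<lo → vanish (suc l) (s≤s l<lo)))
        (cong (_+ sumBelow n (f ∘ suc)) (sym (vanish 0 (s≤s z≤n))))

sumFromTo≡sumBelow : ∀ lo hi f → (∀ l → l < lo → f l ≡ 0) → sumFromTo lo hi f ≡ sumBelow (suc hi) f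
sumFromTo≡sumBelow lo hi f vanish = begin
  sum (map (λ t → f (lo + t)) (upTo (suc hi ∸ lo)))  ≡⟨ cong sum (map-upTo _ (suc hi ∸ lo)) ⟩
  sum (applyUpTo (λ t → f (lo + t)) (suc hi ∸ lo))   ≡⟨ sum-applyUpTo (suc hi ∸ lo) _ ⟩
  sumBelow (suc hi ∸ lo) (λ t → f (lo + t))          ≡⟨ sumBelow-shift lo (suc hi) f vanish ⟩
  sumBelow (suc hi) f                                ∎
  where open ≡-Reasoning

alternating : ℕ → ℕ → ℕ → Bool
alternating K m j = (K ≤ᵇ suc j) ∧ ((m ∸ suc j) % 2 ≡ᵇ 1)

antiregString≗alternating : ∀ K m → antiregString K m ≗ alternating K m ∘ toℕ
antiregString≗alternating K m i with m <ᵇ K in m<K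
... | true  = sym (cong (_∧ _) (>⇒≤ᵇ≡false (≤-trans (s≤s (toℕ<n i)) (<ᵇ⇒< m K (Equivalence.from T-≡ m<K)))))
... | false = refl

2n∸[1+2i]≡1+2[n∸[1+i]] : ∀ n i → i < n → 2 * n ∸ suc (2 * i) ≡ suc (2 * (n ∸ suc i))
2n∸[1+2i]≡1+2[n∸[1+i]] (suc n) zero    _         = cong (_∸ 1) (*-suc 2 n)
2n∸[1+2i]≡1+2[n∸[1+i]] (suc n) (suc i) (s≤s i<n) =
  trans (cong₂ (λ a c → a ∸ suc c) (*-suc 2 n) (*-suc 2 i)) (2n∸[1+2i]≡1+2[n∸[1+i]] n i i<n)

[2n∸[1+2i]]%2≡1 : ∀ {n i} → i < n → (2 * n ∸ suc (2 * i)) % 2 ≡ 1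
[2n∸[1+2i]]%2≡1 {n} {i} i<n = trans (cong (_% 2) gap) ([m+kn]%n≡m%n 1 (n ∸ suc i) 2)
  where
  gap : 2 * n ∸ suc (2 * i) ≡ 1 + (n ∸ suc i) * 2
  gap = trans (2n∸[1+2i]≡1+2[n∸[1+i]] n i i<n) (cong suc (*-comm 2 (n ∸ suc i)))

[2n∸[2+2i]]%2≡0 : ∀ {n i} → i < n → (2 * n ∸ suc (suc (2 * i))) % 2 ≡ 0
[2n∸[2+2i]]%2≡0 {n} {i} i<n = trans (cong (_% 2) gap) (m*n%n≡0 (n ∸ suc i) 2)
  where
  gap : 2 * n ∸ suc (suc (2 * i)) ≡ (n ∸ suc i) * 2
  gap = trans (sym (pred[m∸n]≡m∸[1+n] (2 * n) (suc (2 * i))))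
              (trans (cong pred (2n∸[1+2i]≡1+2[n∸[1+i]] n i i<n)) (*-comm 2 (n ∸ suc i)))

alternating-even : ∀ K {n i} → i < n → alternating K (2 * n) (2 * i) ≡ (K ≤ᵇ suc (2 * i))
alternating-even K {i = i} i<n =
  trans (cong (λ t → (K ≤ᵇ suc (2 * i)) ∧ (t ≡ᵇ 1)) ([2n∸[1+2i]]%2≡1 i<n)) (∧-identityʳ _)

alternating-odd : ∀ K {n i} → i < n → alternating K (2 * n) (suc (2 * i)) ≡ false
alternating-odd K {i = i} i<n =
  trans (cong (λ t → (K ≤ᵇ 2 + 2 * i) ∧ (t ≡ᵇ 1)) ([2n∸[2+2i]]%2≡0 i<n)) (∧-zeroʳ _)

module AlternatingCounts (k n : ℕ) where

  bits : ℕ → Bool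
  bits = alternating (suc k) (2 * n)

  a a⁺ : ℕ → ℕ
  a  m = indepCoeff (suc k) {m} (bits ∘ toℕ) (suc k)
  a⁺ m = indepCoeff (suc k) {m} (bits ∘ toℕ) (2 + k)

  a-suc : ∀ m → a (suc m) ≡ a m + (if bits m then 0 else m C k)
  a-suc m = trans (indepCoeff-∷ʳ k bits m k ≤-refl)
                  (cong (λ t → a m + (if bits m then 0 else t)) (indepCoeff-belowEdgeSize k (bits ∘ toℕ)))

  a⁺-suc : ∀ m → a⁺ (suc m) ≡ a⁺ m + (if bits m then 0 else a m)
  a⁺-suc m = indepCoeff-∷ʳ k bits m (suc k) (n≤1+n k)

  -- Vertex 2 * i is the paper's vertex 2i+1: its bit is 1 once it can top an edge, so it never counts.
  skipped-at-even : ∀ {i} → i < n → ∀ x → (2 * i < k → x ≡ 0) → (if bits (2 * i) then 0 else x) ≡ 0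
  skipped-at-even {i} i<n x vanish rewrite alternating-even (suc k) i<n | suc≤ᵇsuc k (2 * i)
    with k ≤ᵇ 2 * i | ≤ᵇ-reflects-≤ k (2 * i)
  ... | true  | _        = refl
  ... | false | ofⁿ k≰2i = vanish (≰⇒> k≰2i)

  step-even : ∀ {i} → i < n → a (suc (2 * i)) ≡ a (2 * i) × a⁺ (suc (2 * i)) ≡ a⁺ (2 * i)
  step-even {i} i<n =
      trans (a-suc _) (trans (cong (a (2 * i) +_) (skipped-at-even i<n _ k>n⇒nCk≡0)) (+-identityʳ _))
    , trans (a⁺-suc _) (trans (cong (a⁺ (2 * i) +_) (skipped-at-even i<n _ noLargeSets)) (+-identityʳ _))
    where
    noLargeSets : 2 * i < k → a (2 * i) ≡ 0
    noLargeSets 2i<k = indepCoeff-vanishes (suc k) (bits ∘ toℕ) (m<n⇒m<1+n 2i<k)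

  step-odd : ∀ {i} → i < n →
    a (2 + 2 * i) ≡ a (suc (2 * i)) + suc (2 * i) C k × a⁺ (2 + 2 * i) ≡ a⁺ (suc (2 * i)) + a (suc (2 * i))
  step-odd {i} i<n =
      trans (a-suc _) (cong (λ t → a (suc (2 * i)) + (if t then 0 else suc (2 * i) C k)) bit≡0)
    , trans (a⁺-suc _) (cong (λ t → a⁺ (suc (2 * i)) + (if t then 0 else a (suc (2 * i)))) bit≡0)
    where
    bit≡0 : bits (suc (2 * i)) ≡ false
    bit≡0 = alternating-odd (suc k) i<n

  f : ℕ → ℕ
  f l = (2 * l ∸ 1) C k

  closed-forms : 1 ≤ k → ∀ i → i ≤ n →
    a (2 * i) ≡ sumBelow (suc i) f × a⁺ (2 * i) ≡ sumBelow i (λ l → f l * (i ∸ l))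
  closed-forms (s≤s z≤n) zero    _     = refl , refl
  closed-forms 1≤k       (suc i) 1+i≤n = a-closed , a⁺-closed
    where
    open ≡-Reasoning
    IH = closed-forms 1≤k i (≤-trans (n≤1+n i) 1+i≤n)
    even = step-even 1+i≤n
    odd = step-odd 1+i≤n
    a-closed : a (2 * suc i) ≡ sumBelow (2 + i) f
    a-closed = begin
      a (2 * suc i)                      ≡⟨ cong a (*-suc 2 i) ⟩
      a (2 + 2 * i)                      ≡⟨ proj₁ odd ⟩
      a (suc (2 * i)) + suc (2 * i) C k  ≡⟨ cong₂ _+_ (trans (proj₁ even) (proj₁ IH))
                                                      (cong (λ t → (t ∸ 1) C k) (sym (*-suc 2 i))) ⟩
      sumBelow (suc i) f + f (suc i)     ≡⟨ sumBelow-suc (suc i) f ⟨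
      sumBelow (2 + i) f                 ∎
    a⁺-closed : a⁺ (2 * suc i) ≡ sumBelow (suc i) (λ l → f l * (suc i ∸ l))
    a⁺-closed = begin
      a⁺ (2 * suc i)                                        ≡⟨ cong a⁺ (*-suc 2 i) ⟩
      a⁺ (2 + 2 * i)                                        ≡⟨ proj₂ odd ⟩
      a⁺ (suc (2 * i)) + a (suc (2 * i))                    ≡⟨ cong₂ _+_ (trans (proj₂ even) (proj₂ IH))
                                                                         (trans (proj₁ even) (proj₁ IH)) ⟩
      sumBelow i (λ l → f l * (i ∸ l)) + sumBelow (suc i) f ≡⟨ sumBelow-weighted-suc f i ⟨
      sumBelow (suc i) (λ l → f l * (suc i ∸ l))            ∎

[2l∸1]Ck≡0 : ∀ k l → 1 ≤ k → l < (suc k + 1) / 2 → (2 * l ∸ 1) C k ≡ 0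
[2l∸1]Ck≡0 k l 1≤k l<lo = k>n⇒nCk≡0 (pred-< 2l≤k)
  where
  2l≤k : 2 * l ≤ k
  2l≤k = subst (_≤ k) (*-comm l 2)
    (≤-pred (≤-pred (subst (suc l * 2 ≤_) (cong suc (+-comm k 1))
                           (≤-trans (*-monoˡ-≤ 2 l<lo) (m/n*n≤m (suc k + 1) 2)))))
  pred-< : ∀ {x} → x ≤ k → x ∸ 1 < k
  pred-< {zero}  _   = 1≤k
  pred-< {suc x} x<k = x<k

lemma3p3 : (k : ℕ) → 3 ≤ k → (n : ℕ) → 1 ≤ n →
    (antiregCoeff k (2 * n) k
        ≡ sumFromTo ((k + 1) / 2) n (λ i → (2 * i ∸ 1) C (k ∸ 1)))
    × (antiregCoeff k (2 * n) (k + 1)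
        ≡ sumFromTo ((k + 1) / 2) (n ∸ 1) (λ i → ((2 * i ∸ 1) C (k ∸ 1)) * (n ∸ i)))
lemma3p3 (suc k) (s≤s (s≤s (s≤s z≤n))) n@(suc n-1) (s≤s z≤n) = coeffK , coeffK+1
  where
  open ≡-Reasoning
  open AlternatingCounts k n
  closed = closed-forms (s≤s z≤n) n ≤-refl
  string≗ = antiregString≗alternating (suc k) (2 * n)
  vanish : ∀ l → l < (suc k + 1) / 2 → f l ≡ 0
  vanish l = [2l∸1]Ck≡0 k l (s≤s z≤n)
  coeffK = begin
    antiregCoeff (suc k) (2 * n) (suc k)      ≡⟨ indepCoeff-cong (suc k) string≗ (suc k) ⟩
    a (2 * n)                                 ≡⟨ proj₁ closed ⟩
    sumBelow (suc n) f                        ≡⟨ sumFromTo≡sumBelow _ n f vanish ⟨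
    sumFromTo ((suc k + 1) / 2) n f           ∎
  coeffK+1 = begin
    antiregCoeff (suc k) (2 * n) (suc k + 1)  ≡⟨ cong (antiregCoeff (suc k) (2 * n)) (+-comm (suc k) 1) ⟩
    antiregCoeff (suc k) (2 * n) (2 + k)      ≡⟨ indepCoeff-cong (suc k) string≗ (2 + k) ⟩
    a⁺ (2 * n)                                ≡⟨ proj₂ closed ⟩
    sumBelow n (λ l → f l * (n ∸ l))          ≡⟨ sumFromTo≡sumBelow _ n-1 _ (λ l l<lo → cong (_* (n ∸ l)) (vanish l l<lo)) ⟨
    sumFromTo ((suc k + 1) / 2) n-1 (λ l → f l * (n ∸ l)) ∎
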